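{- Let \(\vec G\) be an irreflexive oriented graph. If \(\vec G\) is complete convex, then \(\chi(\vec G)=\chi_s(\vec G)\).
   Context: Oriented graphs are anti-symmetric digraphs without parallel arcs, connected, with at least two vertices; irreflexive means no loops. A homomorphism \(\phi:\vec G\to\vec H\) is a vertex map with \(\phi(u)\phi(v)\in A_{\vec H}\) for each arc \(uv\). \(\chi(\vec G)\) is the least \(k\) such that \(\vec G\to\vec T\) for some (loopless) tournament \(\vec T\) on \(k\) vertices. \(\chi_s(\vec G)\) (simple chromatic number) is the least \(k\) such that there is a non-trivial homomorphism of \(\vec G\) to some reflexive tournament (a tournament with a loop at every vertex) on \(k\) vertices, where a homomorphism is trivial if every arc is mapped to the same loop. A \(2\)-dipath \(u,v,w\) with centre \(v\): \(uv,vw\) arcs, \(u\ne v\ne w\). A vertex set \(S\) is convex if no vertex outside \(S\) is the centre of a \(2\)-dipath with ends in \(S\); \(conv(S)\) is the smallest convex superset; \(\vec G\) is complete convex if \(conv(\{u,v\})=V_G\) for every arc \(uv\). -}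

module Defs where

open import Data.Nat using (ℕ; _≤_)
open import Data.Fin using (Fin)
open import Data.Product using (Σ; _×_; ∃)
open import Data.Sum using (_⊎_)
open import Relation.Nullary using (¬_)
open import Relation.Binary.PropositionalEquality using (_≡_; _≢_)

data Reach {n : ℕ} (A : Fin n → Fin n → Set) : Fin n → Fin n → Set where
  here : ∀ {u} → Reach A u u
  fwd  : ∀ {u v w} → A u v → Reach A v w → Reach A u w
  bwd  : ∀ {u v w} → A v u → Reach A v w → Reach A u w

-- An oriented graph (paper's standing assumptions): finite vertex set Fin n,
-- arcs given by a relation (so no parallel arcs), anti-symmetric,
-- connected, at least two vertices.
record OrientedGraph : Set₁ where
  field
    n         : ℕ
    Arc       : Fin n → Fin n → Set
    antisym   : ∀ {u v} → Arc u v → Arc v u → u ≡ v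
    connected : ∀ u v → Reach Arc u v
    twoVerts  : 2 ≤ n

Irreflexive : OrientedGraph → Set
Irreflexive G = ∀ u → ¬ Arc u u
  where open OrientedGraph G

IsTournament : {k : ℕ} → (Fin k → Fin k → Set) → Set
IsTournament {k} T =
  (∀ x → ¬ T x x) ×
  (∀ x y → x ≢ y → (T x y ⊎ T y x) × ¬ (T x y × T y x))

IsReflexiveTournament : {k : ℕ} → (Fin k → Fin k → Set) → Set
IsReflexiveTournament {k} T =
  (∀ x → T x x) ×
  (∀ x y → x ≢ y → (T x y ⊎ T y x) × ¬ (T x y × T y x))

module _ (G : OrientedGraph) where
  open OrientedGraph G

  IsHom : {k : ℕ} → (Fin k → Fin k → Set) → (Fin n → Fin k) → Set
  IsHom T φ = ∀ u v → Arc u v → T (φ u) (φ v)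

  Trivial : {k : ℕ} → (Fin n → Fin k) → Set
  Trivial {k} φ = Σ (Fin k) λ w → ∀ u v → Arc u v → (φ u ≡ w) × (φ v ≡ w)

  Colourable : ℕ → Set₁
  Colourable k = Σ (Fin k → Fin k → Set) λ T → IsTournament T ×
                   Σ (Fin n → Fin k) λ φ → IsHom T φ

  SimpleColourable : ℕ → Set₁
  SimpleColourable k = Σ (Fin k → Fin k → Set) λ T → IsReflexiveTournament T ×
                         Σ (Fin n → Fin k) λ φ → IsHom T φ × ¬ Trivial φ

  IsOrientedChromaticNumber : ℕ → Set₁
  IsOrientedChromaticNumber k = Colourable k × (∀ j → Colourable j → k ≤ j)

  IsSimpleChromaticNumber : ℕ → Set₁
  IsSimpleChromaticNumber k = SimpleColourable k × (∀ j → SimpleColourable j → k ≤ j)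

  Convex : (Fin n → Set) → Set
  Convex S = ∀ u v w → S u → S w → Arc u v → Arc v w → u ≢ v → v ≢ w → S v

  ConvHullIsAll : Fin n → Fin n → Set₁
  ConvHullIsAll u v = ∀ (S : Fin n → Set) → Convex S → S u → S v → ∀ x → S x

  CompleteConvex : Set₁
  CompleteConvex = ∀ u v → Arc u v → ConvHullIsAll u v

-- A homomorphism to a tournament becomes non-trivial once loops are added, and a
-- non-trivial homomorphism to a reflexive tournament becomes loop-free once loops are
-- removed, provided no arc is mapped to a loop. For a complete convex graph the latter
-- holds: the fibres of a homomorphism to a reflexive tournament are convex, so a fibre
-- containing both ends of an arc is everything and the homomorphism is trivial.
module Submission where

open import Defs
open import Data.Nat using (ℕ; _≤_; suc; s≤s; z≤n)
open import Data.Nat.Properties using (≤-antisym)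
open import Data.Fin using (Fin; zero; suc; _≟_)
open import Data.Product using (_×_; _,_; proj₁; proj₂; ∃₂)
open import Data.Sum as Sum using (_⊎_; inj₁; inj₂)
open import Data.Empty using (⊥-elim)
open import Function using (_∘_; flip)
open import Relation.Nullary using (¬_; yes; no)
open import Relation.Binary.PropositionalEquality using (_≡_; _≢_; refl; sym; subst; subst₂)

reflexiveClosure : {k : ℕ} → (Fin k → Fin k → Set) → Fin k → Fin k → Set
reflexiveClosure T x y = T x y ⊎ x ≡ y

irreflexiveKernel : {k : ℕ} → (Fin k → Fin k → Set) → Fin k → Fin k → Set
irreflexiveKernel T x y = T x y × x ≢ y

reflexiveClosure-isReflexiveTournament : {k : ℕ} {T : Fin k → Fin k → Set} →
  IsTournament T → IsReflexiveTournament (reflexiveClosure T)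
reflexiveClosure-isReflexiveTournament {T = T} (_ , tour) =
  (λ _ → inj₂ refl) , λ x y x≢y → Sum.map inj₁ inj₁ (proj₁ (tour x y x≢y)) , noBoth x y x≢y
  where
  noBoth : ∀ x y → x ≢ y → ¬ (reflexiveClosure T x y × reflexiveClosure T y x)
  noBoth x y x≢y (inj₁ t , inj₁ t′) = proj₂ (tour x y x≢y) (t , t′)
  noBoth x y x≢y (inj₂ x≡y , _)     = x≢y x≡y
  noBoth x y x≢y (_ , inj₂ y≡x)     = x≢y (sym y≡x)

irreflexiveKernel-isTournament : {k : ℕ} {T : Fin k → Fin k → Set} →
  IsReflexiveTournament T → IsTournament (irreflexiveKernel T)
irreflexiveKernel-isTournament (_ , tour) =
  (λ x (_ , x≢x) → x≢x refl) ,
  λ x y x≢y → Sum.map (_, x≢y) (_, x≢y ∘ sym) (proj₁ (tour x y x≢y)) ,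
              λ ((t , _) , (t′ , _)) → proj₂ (tour x y x≢y) (t , t′)

module _ (G : OrientedGraph) where
  open OrientedGraph G

  hasArc : ∃₂ Arc
  hasArc = arcOnPath twoVerts
    where
    arcOnPath : 2 ≤ n → ∃₂ Arc
    arcOnPath (s≤s (s≤s z≤n)) with connected zero (suc zero)
    ... | fwd {v = v} a _ = zero , v , a
    ... | bwd {v = v} a _ = v , zero , a

  hom-irreflexive⇒nonTrivial : {k : ℕ} {T : Fin k → Fin k → Set} {φ : Fin n → Fin k} →
    (∀ x → ¬ T x x) → IsHom G T φ → ¬ Trivial G φ
  hom-irreflexive⇒nonTrivial {T = T} irr hom (w , trivial) =
    let (u , v , a) = hasArc
        (φu≡w , φv≡w) = trivial u v a
    in irr w (subst₂ T φu≡w φv≡w (hom u v a))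

  colourable⇒simpleColourable : ∀ k → Colourable G k → SimpleColourable G k
  colourable⇒simpleColourable k (T , isT@(irr , _) , φ , hom) =
    reflexiveClosure T , reflexiveClosure-isReflexiveTournament {T = T} isT , φ ,
    (λ u v → inj₁ ∘ hom u v) , hom-irreflexive⇒nonTrivial {T = T} irr hom

  hom-fibre-convex : {k : ℕ} {T : Fin k → Fin k → Set} {φ : Fin n → Fin k} →
    IsReflexiveTournament T → IsHom G T φ → ∀ c → Convex G (λ x → φ x ≡ c)
  hom-fibre-convex {T = T} {φ} (_ , tour) hom c u v w φu≡c φw≡c uv vw _ _ with φ v ≟ c
  ... | yes φv≡c = φv≡c
  ... | no  φv≢c = ⊥-elim (proj₂ (tour c (φ v) (φv≢c ∘ sym))
                     (subst (flip T (φ v)) φu≡c (hom u v uv) ,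
                      subst (T (φ v)) φw≡c (hom v w vw)))

  module _ (cc : CompleteConvex G) where

    nonTrivial⇒arcs-separated : {k : ℕ} {T : Fin k → Fin k → Set} {φ : Fin n → Fin k} →
      IsReflexiveTournament T → IsHom G T φ → ¬ Trivial G φ → ∀ u v → Arc u v → φ u ≢ φ v
    nonTrivial⇒arcs-separated {φ = φ} isT hom nonTrivial u v a φu≡φv =
      nonTrivial (φ v , λ x y _ → constant x , constant y)
      where
      constant : ∀ x → φ x ≡ φ v
      constant = cc u v a _ (hom-fibre-convex isT hom (φ v)) φu≡φv refl

    simpleColourable⇒colourable : ∀ k → SimpleColourable G k → Colourable G k
    simpleColourable⇒colourable k (T , isT , φ , hom , nonTrivial) =
      irreflexiveKernel T , irreflexiveKernel-isTournament isT , φ ,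
      λ u v a → hom u v a , nonTrivial⇒arcs-separated isT hom nonTrivial u v a

theorem34 : (G : OrientedGraph) → Irreflexive G → CompleteConvex G →
    (k ks : ℕ) → IsOrientedChromaticNumber G k → IsSimpleChromaticNumber G ks →
    k ≡ ks
theorem34 G _ cc k ks (colourable , k-least) (simpleColourable , ks-least) =
  ≤-antisym (k-least ks (simpleColourable⇒colourable G cc ks simpleColourable))
            (ks-least k (colourable⇒simpleColourable G k colourable))
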